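{- Let $X$ and $Y$ be Morris counters with a common base $b$, run (with independent randomness) on streams of $n_1$ and $n_2$ insertions respectively. Define $Z$ by the following merging procedure: set $Z\leftarrow X$; then for $i=1,2,\dots,Y$, set $Z\leftarrow Z+1$ with probability $b^{ -Z+i-1}$ and leave $Z$ unchanged otherwise (independently). Then $Z$ is distributed identically to a Morris counter with base $b$ run on a stream of $n_1+n_2$ insertions.
   Context: A Morris counter with base $1<b\le 2$ initializes $C\leftarrow 0$; on each insertion it sets $C\leftarrow C+1$ with probability $b^{ -C}$ and leaves $C$ unchanged otherwise, using independent randomness per insertion. -}

module Defs where

open import Algebra.Bundles using (CommutativeRing)
open import Data.Nat using (ℕ; zero; suc; _∸_; _≟_)
open import Data.List using (List; []; _∷_; _++_; map)
open import Data.Product using (_×_; _,_)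
open import Data.Bool using (if_then_else_)
open import Relation.Nullary.Decidable using (⌊_⌋)

-- Finitely supported distributions with weights ("probabilities") in a
-- commutative ring R.
-- Running a further random step with fresh independent randomness is `bind`.
-- `binv` plays the role of b⁻¹, so b^{-m} = pow binv m.
module Morris {c ℓ} (R : CommutativeRing c ℓ) (binv : CommutativeRing.Carrier R) where
  open CommutativeRing R

  Dist : Set → Set c
  Dist A = List (Carrier × A)

  return : {A : Set} → A → Dist A
  return a = (1# , a) ∷ []

  scale : {A : Set} → Carrier → Dist A → Dist A
  scale w = map (λ { (v , a) → (w * v , a) })

  bind : {A B : Set} → Dist A → (A → Dist B) → Dist B
  bind [] f = []
  bind ((w , a) ∷ d) f = scale w (f a) ++ bind d f

  pow : Carrier → ℕ → Carrier
  pow x zero = 1#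
  pow x (suc n) = x * pow x n

  coin : {A : Set} → Carrier → A → A → Dist A
  coin p a a' = (p , a) ∷ ((1# - p) , a') ∷ []

  mass : Dist ℕ → ℕ → Carrier
  mass [] k = 0#
  mass ((w , v) ∷ d) k = (if ⌊ v ≟ k ⌋ then w else 0#) + mass d k

  insert : ℕ → Dist ℕ
  insert C = coin (pow binv C) (suc C) C

  runFrom : ℕ → ℕ → Dist ℕ
  runFrom C zero = return C
  runFrom C (suc n) = bind (insert C) (λ C' → runFrom C' n)

  morris : ℕ → Dist ℕ
  morris n = runFrom 0 n

  -- merge loop: j = i-1 is the number of steps already done, r the number of
  -- remaining steps, z the current value of Z.  At step i, Z ← Z+1 with
  -- probability b^{-Z+i-1} = b^{-(Z-(i-1))}.  (Along every run Z ≥ i-1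
  -- before step i, so the truncated subtraction ∸ is exact.)
  mergeLoop : ℕ → ℕ → ℕ → Dist ℕ
  mergeLoop j zero z = return z
  mergeLoop j (suc r) z =
    bind (coin (pow binv (z ∸ j)) (suc z) z) (λ z' → mergeLoop (suc j) r z')

  mergeVals : ℕ → ℕ → Dist ℕ
  mergeVals x y = mergeLoop 0 y x

  merged : ℕ → ℕ → Dist ℕ
  merged n₁ n₂ = bind (morris n₁) (λ x → bind (morris n₂) (λ y → mergeVals x y))

-- Distributions are weighted lists over a commutative ring, and we compare
-- them through expectations  𝔼[ d ] h = Σ weight · h(outcome); the mass at k
-- is the expectation of the indicator of k.  The core of the argument is
-- the invariant (merge-runFrom): for j ≤ z, let Y be a counter started at
-- value j and run for n insertions, and let Z start at z and perform the
-- merge steps j+1, …, Y; then Z is distributed like a counter started at z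
-- and run for n insertions.  It is proved by induction on n: whenever Y
-- increments (probability b^{-j}) the merge performs one more step, which
-- increments Z with probability b^{-(z-j)}, and the two coins combine into
-- a single coin of probability b^{-z}, which is exactly the next insertion
-- of a counter at value z.  Unfolding a merge step uses that Y never drops
-- below its start (support of runFrom); when j = z the merge coin is
-- certain, so its failure branch, where the invariant would need j+1 ≤ z,
-- has weight 0.
-- The theorem follows by taking j = 0, z = X, and splitting a run of
-- n₁ + n₂ insertions into runs of n₁ and n₂ insertions (runFrom-+).
module Submission where

open import Defs
open import Algebra.Bundles using (CommutativeRing)
open import Data.Nat as ℕ using (ℕ; zero; suc; _∸_; _≤_; _<_; z≤n; s≤s; _≟_)
open import Data.Nat.Properties
  using (≤-refl; ≤-trans; n≤1+n; m≤n⇒m<n∨m≡n; +-∸-assoc; n∸n≡0; m+[n∸m]≡n)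
open import Data.List using ([]; _∷_; _++_)
open import Data.List.Relation.Unary.All as All using (All; []; _∷_)
open import Data.List.Relation.Unary.All.Properties using (++⁺; map⁺)
open import Data.Product using (_,_; proj₂)
open import Data.Sum using (inj₁; inj₂)
open import Data.Bool using (true; false; if_then_else_)
open import Relation.Nullary.Decidable using (⌊_⌋)
import Relation.Binary.PropositionalEquality as P
import Relation.Binary.Reasoning.Setoid as SetoidReasoning

module MorrisMerge {c ℓ} (R : CommutativeRing c ℓ) (binv : CommutativeRing.Carrier R) where
  open CommutativeRing R
  open Morris R binv
  open SetoidReasoning setoid
  open import Algebra.Solver.Ring.NaturalCoefficients.Default commutativeSemiring
    using (solve; _:=_; _:+_; _:*_)

  𝔼[_] : {A : Set} → Dist A → (A → Carrier) → Carrier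
  𝔼[ [] ] h = 0#
  𝔼[ (w , a) ∷ d ] h = w * h a + 𝔼[ d ] h

  SupportedOn : {A : Set} → (A → Set) → Dist A → Set c
  SupportedOn P d = All (λ wa → P (proj₂ wa)) d

  𝔼-cong-on : {A : Set} {P : A → Set} {d : Dist A} {f g : A → Carrier} →
    SupportedOn P d → (∀ a → P a → f a ≈ g a) → 𝔼[ d ] f ≈ 𝔼[ d ] g
  𝔼-cong-on [] f≈g = refl
  𝔼-cong-on (pa ∷ supp) f≈g = +-cong (*-congˡ (f≈g _ pa)) (𝔼-cong-on supp f≈g)

  𝔼-cong : {A : Set} (d : Dist A) {f g : A → Carrier} →
    (∀ a → f a ≈ g a) → 𝔼[ d ] f ≈ 𝔼[ d ] g
  𝔼-cong [] f≈g = refl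
  𝔼-cong ((w , a) ∷ d) f≈g = +-cong (*-congˡ (f≈g a)) (𝔼-cong d f≈g)

  𝔼-return : {A : Set} (a : A) (h : A → Carrier) → 𝔼[ return a ] h ≈ h a
  𝔼-return a h = trans (+-identityʳ _) (*-identityˡ _)

  𝔼-coin : {A : Set} (p : Carrier) (a a' : A) (h : A → Carrier) →
    𝔼[ coin p a a' ] h ≈ p * h a + (1# - p) * h a'
  𝔼-coin p a a' h = +-congˡ (+-identityʳ _)

  𝔼-++ : {A : Set} (d e : Dist A) (h : A → Carrier) →
    𝔼[ d ++ e ] h ≈ 𝔼[ d ] h + 𝔼[ e ] h
  𝔼-++ [] e h = sym (+-identityˡ _)
  𝔼-++ ((w , a) ∷ d) e h = trans (+-congˡ (𝔼-++ d e h)) (sym (+-assoc _ _ _))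

  𝔼-scale : {A : Set} (w : Carrier) (d : Dist A) (h : A → Carrier) →
    𝔼[ scale w d ] h ≈ w * 𝔼[ d ] h
  𝔼-scale w [] h = sym (zeroʳ w)
  𝔼-scale w ((v , a) ∷ d) h = begin
    (w * v) * h a + 𝔼[ scale w d ] h ≈⟨ +-cong (*-assoc w v (h a)) (𝔼-scale w d h) ⟩
    w * (v * h a) + w * 𝔼[ d ] h     ≈⟨ distribˡ w _ _ ⟨
    w * (v * h a + 𝔼[ d ] h)         ∎

  𝔼-bind : {A B : Set} (d : Dist A) (f : A → Dist B) (h : B → Carrier) →
    𝔼[ bind d f ] h ≈ 𝔼[ d ] (λ a → 𝔼[ f a ] h)
  𝔼-bind [] f h = refl
  𝔼-bind ((w , a) ∷ d) f h = begin
    𝔼[ scale w (f a) ++ bind d f ] h        ≈⟨ 𝔼-++ (scale w (f a)) (bind d f) h ⟩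
    𝔼[ scale w (f a) ] h + 𝔼[ bind d f ] h ≈⟨ +-cong (𝔼-scale w (f a) h) (𝔼-bind d f h) ⟩
    w * 𝔼[ f a ] h + 𝔼[ d ] (λ a → 𝔼[ f a ] h) ∎

  𝔼-bind-coin : {A B : Set} (p : Carrier) (a a' : A) (f : A → Dist B) (h : B → Carrier) →
    𝔼[ bind (coin p a a') f ] h ≈ p * 𝔼[ f a ] h + (1# - p) * 𝔼[ f a' ] h
  𝔼-bind-coin p a a' f h = trans (𝔼-bind (coin p a a') f h) (𝔼-coin p a a' _)

  𝔼-linear : {A : Set} (d : Dist A) (x y : Carrier) (f g : A → Carrier) →
    𝔼[ d ] (λ a → x * f a + y * g a) ≈ x * 𝔼[ d ] f + y * 𝔼[ d ] g
  𝔼-linear [] x y f g = sym (trans (+-cong (zeroʳ x) (zeroʳ y)) (+-identityʳ 0#))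
  𝔼-linear ((w , a) ∷ d) x y f g =
    trans (+-congˡ (𝔼-linear d x y f g)) (regroup w x y (f a) (g a) (𝔼[ d ] f) (𝔼[ d ] g))
    where
    regroup : ∀ w x y u v U V → w * (x * u + y * v) + (x * U + y * V)
                                ≈ x * (w * u + U) + y * (w * v + V)
    regroup = solve 7 (λ w x y u v U V → w :* (x :* u :+ y :* v) :+ (x :* U :+ y :* V)
                                      := x :* (w :* u :+ U) :+ y :* (w :* v :+ V)) refl

  supported-bind : {A B : Set} {P : A → Set} {Q : B → Set} {d : Dist A} {f : A → Dist B} →
    SupportedOn P d → (∀ a → P a → SupportedOn Q (f a)) → SupportedOn Q (bind d f)
  supported-bind [] supp-f = []
  supported-bind (pa ∷ supp-d) supp-f = ++⁺ (map⁺ (supp-f _ pa)) (supported-bind supp-d supp-f)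

  indicator : ℕ → ℕ → Carrier
  indicator k v = if ⌊ v ≟ k ⌋ then 1# else 0#

  mass≈𝔼-indicator : (d : Dist ℕ) (k : ℕ) → mass d k ≈ 𝔼[ d ] (indicator k)
  mass≈𝔼-indicator [] k = refl
  mass≈𝔼-indicator ((w , v) ∷ d) k with ⌊ v ≟ k ⌋
  ... | true  = +-cong (sym (*-identityʳ w)) (mass≈𝔼-indicator d k)
  ... | false = +-cong (sym (zeroʳ w)) (mass≈𝔼-indicator d k)

  pow-+ : ∀ m n → pow binv (m ℕ.+ n) ≈ pow binv m * pow binv n
  pow-+ zero n = sym (*-identityˡ _)
  pow-+ (suc m) n = trans (*-congˡ (pow-+ m n)) (sym (*-assoc _ _ _))

  complement-product : ∀ p q → 1# - p * q ≈ (1# - p) + p * (1# - q)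
  complement-product p q = sym (begin
    (1# - p) + p * (1# - q)           ≈⟨ +-congˡ (distribˡ p 1# (- q)) ⟩
    (1# - p) + (p * 1# + p * - q)     ≈⟨ +-congˡ (+-cong (*-identityʳ p) (sym (-‿distribʳ-* p q))) ⟩
    (1# + - p) + (p + - (p * q))      ≈⟨ +-assoc 1# (- p) _ ⟩
    1# + (- p + (p + - (p * q)))      ≈⟨ +-congˡ (+-assoc (- p) p _) ⟨
    1# + ((- p + p) + - (p * q))      ≈⟨ +-congˡ (+-congʳ (-‿inverseˡ p)) ⟩
    1# + (0# + - (p * q))             ≈⟨ +-congˡ (+-identityˡ _) ⟩
    1# - p * q                        ∎)
    where open import Algebra.Properties.Ring ring using (-‿distribʳ-*)

  -- Tossing a p-coin and, on success, a q-coin is a single (p·q)-coin.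
  two-coins : ∀ p q A B →
    p * (q * A + (1# - q) * B) + (1# - p) * B ≈ (p * q) * A + (1# - p * q) * B
  two-coins p q A B = begin
    p * (q * A + (1# - q) * B) + (1# - p) * B         ≈⟨ regroup p q (1# - p) (1# - q) A B ⟩
    (p * q) * A + ((1# - p) + p * (1# - q)) * B       ≈⟨ +-congˡ (*-congʳ (complement-product p q)) ⟨
    (p * q) * A + (1# - p * q) * B                    ∎
    where
    regroup : ∀ p q p' q' A B → p * (q * A + q' * B) + p' * B ≈ (p * q) * A + (p' + p * q') * B
    regroup = solve 6 (λ p q p' q' A B → p :* (q :* A :+ q' :* B) :+ p' :* B
                                      := (p :* q) :* A :+ (p' :+ p :* q') :* B) refl

  runFrom-step : ∀ c n (h : ℕ → Carrier) →
    𝔼[ runFrom c (suc n) ] h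
      ≈ pow binv c * 𝔼[ runFrom (suc c) n ] h + (1# - pow binv c) * 𝔼[ runFrom c n ] h
  runFrom-step c n h = 𝔼-bind-coin (pow binv c) (suc c) c (λ c' → runFrom c' n) h

  runFrom-supported : ∀ c n → SupportedOn (c ≤_) (runFrom c n)
  runFrom-supported c zero = ≤-refl ∷ []
  runFrom-supported c (suc n) =
    supported-bind (n≤1+n c ∷ ≤-refl ∷ [])
                   (λ c' c≤c' → All.map (≤-trans c≤c') (runFrom-supported c' n))

  runFrom-+ : ∀ m n c (h : ℕ → Carrier) →
    𝔼[ runFrom c (m ℕ.+ n) ] h ≈ 𝔼[ runFrom c m ] (λ x → 𝔼[ runFrom x n ] h)
  runFrom-+ zero n c h = sym (𝔼-return c (λ x → 𝔼[ runFrom x n ] h))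
  runFrom-+ (suc m) n c h = begin
    𝔼[ runFrom c (suc m ℕ.+ n) ] h
      ≈⟨ 𝔼-bind (insert c) (λ c' → runFrom c' (m ℕ.+ n)) h ⟩
    𝔼[ insert c ] (λ c' → 𝔼[ runFrom c' (m ℕ.+ n) ] h)
      ≈⟨ 𝔼-cong (insert c) (λ c' → runFrom-+ m n c' h) ⟩
    𝔼[ insert c ] (λ c' → 𝔼[ runFrom c' m ] (λ x → 𝔼[ runFrom x n ] h))
      ≈⟨ 𝔼-bind (insert c) (λ c' → runFrom c' m) _ ⟨
    𝔼[ runFrom c (suc m) ] (λ x → 𝔼[ runFrom x n ] h) ∎

  -- Expected value of h(Z) at the end of the merge, when j of the y merge
  -- steps are done and Z currently equals z.
  mergeFrom : ℕ → ℕ → (ℕ → Carrier) → ℕ → Carrier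
  mergeFrom j z h y = 𝔼[ mergeLoop j (y ∸ j) z ] h

  mergeFrom-done : ∀ j z h → mergeFrom j z h j ≈ h z
  mergeFrom-done j z h rewrite n∸n≡0 j = 𝔼-return z h

  mergeFrom-step : ∀ j z h y → j < y →
    mergeFrom j z h y
      ≈ pow binv (z ∸ j) * mergeFrom (suc j) (suc z) h y
        + (1# - pow binv (z ∸ j)) * mergeFrom (suc j) z h y
  mergeFrom-step j z h (suc y) (s≤s j≤y) = begin
    𝔼[ mergeLoop j (suc y ∸ j) z ] h
      ≡⟨ P.cong (λ r → 𝔼[ mergeLoop j r z ] h) (+-∸-assoc 1 j≤y) ⟩
    𝔼[ mergeLoop j (suc (y ∸ j)) z ] h
      ≈⟨ 𝔼-bind-coin (pow binv (z ∸ j)) (suc z) z (λ z' → mergeLoop (suc j) (y ∸ j) z') h ⟩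
    pow binv (z ∸ j) * mergeFrom (suc j) (suc z) h (suc y)
      + (1# - pow binv (z ∸ j)) * mergeFrom (suc j) z h (suc y) ∎

  certain-coin : ∀ j → 1# - pow binv (j ∸ j) ≈ 0#
  certain-coin j = trans (+-congˡ (-‿cong (reflexive (P.cong (pow binv) (n∸n≡0 j)))))
                         (-‿inverseʳ 1#)

  merge-runFrom : ∀ n j z → j ≤ z → (h : ℕ → Carrier) →
    𝔼[ runFrom j n ] (mergeFrom j z h) ≈ 𝔼[ runFrom z n ] h
  merge-runFrom zero j z j≤z h = begin
    𝔼[ return j ] (mergeFrom j z h) ≈⟨ 𝔼-return j (mergeFrom j z h) ⟩
    mergeFrom j z h j               ≈⟨ mergeFrom-done j z h ⟩
    h z                             ≈⟨ 𝔼-return z h ⟨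
    𝔼[ return z ] h                 ∎
  merge-runFrom (suc n) j z j≤z h = begin
    𝔼[ runFrom j (suc n) ] (mergeFrom j z h)
      ≈⟨ runFrom-step j n _ ⟩
    p * 𝔼[ runFrom (suc j) n ] (mergeFrom j z h) + (1# - p) * 𝔼[ runFrom j n ] (mergeFrom j z h)
      ≈⟨ +-cong (*-congˡ Y-increments) (*-congˡ (merge-runFrom n j z j≤z h)) ⟩
    p * (q * A + (1# - q) * B) + (1# - p) * B
      ≈⟨ two-coins p q A B ⟩
    (p * q) * A + (1# - p * q) * B
      ≈⟨ +-cong (*-congʳ pq≈b⁻ᶻ) (*-congʳ (+-congˡ (-‿cong pq≈b⁻ᶻ))) ⟩
    pow binv z * A + (1# - pow binv z) * B
      ≈⟨ runFrom-step z n h ⟨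
    𝔼[ runFrom z (suc n) ] h ∎
    where
    p = pow binv j
    q = pow binv (z ∸ j)
    A = 𝔼[ runFrom (suc z) n ] h
    B = 𝔼[ runFrom z n ] h

    pq≈b⁻ᶻ : p * q ≈ pow binv z
    pq≈b⁻ᶻ = trans (sym (pow-+ j (z ∸ j))) (reflexive (P.cong (pow binv) (m+[n∸m]≡n j≤z)))

    -- If the merge coin fails, Z stays at z while j advances; for j = z
    -- this branch has weight 0.
    Z-stays : (1# - q) * 𝔼[ runFrom (suc j) n ] (mergeFrom (suc j) z h) ≈ (1# - q) * B
    Z-stays with m≤n⇒m<n∨m≡n j≤z
    ... | inj₁ j<z = *-congˡ (merge-runFrom n (suc j) z j<z h)
    ... | inj₂ P.refl = begin
      (1# - q) * 𝔼[ runFrom (suc j) n ] (mergeFrom (suc j) j h) ≈⟨ *-congʳ (certain-coin j) ⟩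
      0# * 𝔼[ runFrom (suc j) n ] (mergeFrom (suc j) j h)       ≈⟨ zeroˡ _ ⟩
      0#                                                        ≈⟨ zeroˡ B ⟨
      0# * B                                                    ≈⟨ *-congʳ (certain-coin j) ⟨
      (1# - q) * B                                              ∎

    -- Y has moved past j, so the merge performs step j+1.
    Y-increments : 𝔼[ runFrom (suc j) n ] (mergeFrom j z h) ≈ q * A + (1# - q) * B
    Y-increments = begin
      𝔼[ runFrom (suc j) n ] (mergeFrom j z h)
        ≈⟨ 𝔼-cong-on (runFrom-supported (suc j) n) (mergeFrom-step j z h) ⟩
      𝔼[ runFrom (suc j) n ] (λ y → q * mergeFrom (suc j) (suc z) h y + (1# - q) * mergeFrom (suc j) z h y)
        ≈⟨ 𝔼-linear (runFrom (suc j) n) q (1# - q) _ _ ⟩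
      q * 𝔼[ runFrom (suc j) n ] (mergeFrom (suc j) (suc z) h)
        + (1# - q) * 𝔼[ runFrom (suc j) n ] (mergeFrom (suc j) z h)
        ≈⟨ +-cong (*-congˡ (merge-runFrom n (suc j) (suc z) (s≤s j≤z) h)) Z-stays ⟩
      q * A + (1# - q) * B ∎

  merged≈morris : ∀ n₁ n₂ (h : ℕ → Carrier) →
    𝔼[ merged n₁ n₂ ] h ≈ 𝔼[ morris (n₁ ℕ.+ n₂) ] h
  merged≈morris n₁ n₂ h = begin
    𝔼[ merged n₁ n₂ ] h
      ≈⟨ 𝔼-bind (morris n₁) _ h ⟩
    𝔼[ morris n₁ ] (λ x → 𝔼[ bind (morris n₂) (mergeVals x) ] h)
      ≈⟨ 𝔼-cong (morris n₁) (λ x → 𝔼-bind (morris n₂) (mergeVals x) h) ⟩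
    𝔼[ morris n₁ ] (λ x → 𝔼[ morris n₂ ] (mergeFrom 0 x h))
      ≈⟨ 𝔼-cong (morris n₁) (λ x → merge-runFrom n₂ 0 x z≤n h) ⟩
    𝔼[ morris n₁ ] (λ x → 𝔼[ runFrom x n₂ ] h)
      ≈⟨ runFrom-+ n₁ n₂ 0 h ⟨
    𝔼[ morris (n₁ ℕ.+ n₂) ] h ∎

open import Data.Nat using (_+_)

lemma17 : ∀ {c ℓ} (R : CommutativeRing c ℓ) (b binv : CommutativeRing.Carrier R) →
    CommutativeRing._≈_ R (CommutativeRing._*_ R b binv) (CommutativeRing.1# R) →
    (n₁ n₂ k : ℕ) →
    CommutativeRing._≈_ R (Morris.mass R binv (Morris.merged R binv n₁ n₂) k)
                          (Morris.mass R binv (Morris.morris R binv (n₁ + n₂)) k)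
lemma17 R b binv _ n₁ n₂ k = begin
  mass (merged n₁ n₂) k             ≈⟨ mass≈𝔼-indicator (merged n₁ n₂) k ⟩
  𝔼[ merged n₁ n₂ ] (indicator k)   ≈⟨ merged≈morris n₁ n₂ (indicator k) ⟩
  𝔼[ morris (n₁ + n₂) ] (indicator k) ≈⟨ mass≈𝔼-indicator (morris (n₁ + n₂)) k ⟨
  mass (morris (n₁ + n₂)) k         ∎
  where
  open CommutativeRing R using (setoid)
  open Morris R binv using (mass; merged; morris)
  open MorrisMerge R binv using (𝔼[_]; indicator; mass≈𝔼-indicator; merged≈morris)
  open SetoidReasoning setoid
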